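{- Let $\mathbf q,\mathbf s\in\mathcal V_{v,c}$ with $\mathbf q\preceq\mathbf s$. Then $P(\mathbf q,\mathbf s)\le P(\mathbf s,\mathbf q)$. Moreover, if $\mathbf q\ne\mathbf s$, then the inequality is strict.
   Context: $\mathcal V_{v,c}$ is the set of non-increasing sequences $(s_1,\dots,s_v)$ of non-negative integers with $s_1+\dots+s_v=c$. For $\mathbf s$, let $\Sigma_i(\mathbf s)=s_1+\dots+s_i$. For $\mathbf q,\mathbf s\in\mathcal V_{v,c}$, write $\mathbf q\preceq\mathbf s$ ($\mathbf s$ majorizes $\mathbf q$) if $\Sigma_i(\mathbf s)\ge\Sigma_i(\mathbf q)$ for every $i\in\{1,\dots,v-1\}$. For $\mathbf s\in\mathcal V_{v,c}$ and $\mathbf q\in\mathcal V_{v,d}$, $P(\mathbf s,\mathbf q)$ is the product, over all $i\in\{1,\dots,v\}$ with $s_i>q_i$, of $s_i(s_i-1)\cdots(q_i+1)$; if $q_i\ge s_i$ for all $i$, then $P(\mathbf s,\mathbf q)=1$. -}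

module Defs where

open import Data.Nat using (ℕ; zero; suc; _+_; _*_; _≤_; _<_; _≤?_)
open import Data.Vec using (Vec; []; _∷_; lookup)
open import Data.Fin using (Fin; fromℕ<; toℕ)
open import Data.Product using (_×_)
open import Relation.Nullary using (yes; no)
open import Relation.Binary.PropositionalEquality using (_≡_)

vsum : ∀ {v} → Vec ℕ v → ℕ
vsum [] = 0
vsum (x ∷ xs) = x + vsum xs

psum : ∀ {v} → ℕ → Vec ℕ v → ℕ
psum zero _ = 0
psum (suc i) [] = 0
psum (suc i) (x ∷ xs) = x + psum i xs

NonIncreasing : ∀ {v} → Vec ℕ v → Set
NonIncreasing {v} s = ∀ (i : ℕ) (h : suc i < v) →
  lookup s (fromℕ< h) ≤ lookup s (fromℕ< {i} (Data.Nat.Properties.<-trans (Data.Nat.Properties.n<1+n i) h))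
  where import Data.Nat.Properties

InV : (v c : ℕ) → Vec ℕ v → Set
InV v c s = NonIncreasing s × vsum s ≡ c

_≼_ : ∀ {v} → Vec ℕ v → Vec ℕ v → Set
_≼_ {v} q s = ∀ (i : ℕ) → 1 ≤ i → i < v → psum i q ≤ psum i s

-- falling product  a (a-1) ⋯ (b+1)  if a > b, and 1 if b ≥ a
ff : ℕ → ℕ → ℕ
ff zero b = 1
ff (suc a) b with b ≤? a
... | yes _ = suc a * ff a b
... | no _ = 1

-- P(s,q) = ∏_i  ff s_i q_i   (factors with q_i ≥ s_i contribute 1)
P : ∀ {v} → Vec ℕ v → Vec ℕ v → ℕ
P [] [] = 1
P (s ∷ ss) (q ∷ qs) = ff s q * P ss qs

-- Since ff a b * b ! ≡ ff b a * a !, the claim is that q ≼ s forces ∏ q_i! ≤ ∏ s_i!, strictly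
-- unless q ≡ s (strict Schur-convexity of the factorial product).  This goes by induction on c:
-- lowering the last entry of the top block of s (resp. q) by one divides the product by the top
-- value s_1 (resp. q_1) and preserves majorization, while q_1 ≤ s_1.  The one delicate point is
-- an index i between the two block ends, where Σ_i(q) < Σ_i(s) must be strict.
module Submission where

open import Defs
open import Data.Nat using (ℕ; zero; suc; pred; _+_; _*_; _≤_; _<_; _≤?_; _<?_; _≟_; z≤n; s≤s; z<s; s<s; _!; >-nonZero)
open import Data.Nat.Properties
open import Algebra.Properties.CommutativeSemigroup *-commutativeSemigroup using (interchange; x∙yz≈y∙xz)
open import Data.Vec using (Vec; []; _∷_; lookup)
open import Data.Fin using (fromℕ<)
open import Data.Product using (_×_; _,_; ∃-syntax)
open import Data.Sum using (_⊎_; inj₁; inj₂)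
open import Function using (_∘_)
open import Relation.Binary using (tri<; tri≈; tri>)
open import Relation.Binary.PropositionalEquality
open import Relation.Nullary using (¬_; yes; no; contradiction)

private
  variable
    c i j k l n v : ℕ
    f g h h′ : ℕ → ℕ

sumBelow : ℕ → (ℕ → ℕ) → ℕ
sumBelow zero    h = 0
sumBelow (suc n) h = h 0 + sumBelow n (h ∘ suc)

factorialProduct : ℕ → (ℕ → ℕ) → ℕ
factorialProduct zero    f = 1
factorialProduct (suc n) f = f 0 ! * factorialProduct n (f ∘ suc)

sumBelow-snoc : ∀ n h → sumBelow (suc n) h ≡ sumBelow n h + h n
sumBelow-snoc zero    h = +-comm (h 0) 0
sumBelow-snoc (suc n) h = trans (cong (h 0 +_) (sumBelow-snoc n (h ∘ suc))) (sym (+-assoc (h 0) _ _))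

sumBelow-mono : ∀ n → (∀ j → h j ≤ h′ j) → sumBelow n h ≤ sumBelow n h′
sumBelow-mono zero    h≤h′ = z≤n
sumBelow-mono (suc n) h≤h′ = +-mono-≤ (h≤h′ 0) (sumBelow-mono n (h≤h′ ∘ suc))

sumBelow-const : ∀ n {x} → (∀ j → j < n → h j ≡ x) → sumBelow n h ≡ n * x
sumBelow-const zero    h≡x = refl
sumBelow-const (suc n) h≡x = cong₂ _+_ (h≡x 0 z<s) (sumBelow-const n (λ j j<n → h≡x (suc j) (s<s j<n)))

sumBelow≡0 : ∀ n → sumBelow n h ≡ 0 → ∀ j → j < n → h j ≡ 0
sumBelow≡0 {h} (suc n) eq zero    _         = m+n≡0⇒m≡0 (h 0) eq
sumBelow≡0 {h} (suc n) eq (suc j) (s<s j<n) = sumBelow≡0 n (m+n≡0⇒n≡0 (h 0) eq) j j<n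

factorialProduct-cong : ∀ n → f ≗ g → factorialProduct n f ≡ factorialProduct n g
factorialProduct-cong zero    f≗g = refl
factorialProduct-cong (suc n) f≗g = cong₂ (λ x y → x ! * y) (f≗g 0) (factorialProduct-cong n (f≗g ∘ suc))

factorialProduct-pos : ∀ n f → 0 < factorialProduct n f
factorialProduct-pos zero    f = z<s
factorialProduct-pos (suc n) f = *-mono-≤ (1≤n! (f 0)) (factorialProduct-pos n (f ∘ suc))

Antitone : (ℕ → ℕ) → Set
Antitone f = ∀ j → f (suc j) ≤ f j

antitone-≤ : Antitone f → i ≤ j → f j ≤ f i
antitone-≤ {i = zero}  {j = zero}  anti _         = ≤-refl
antitone-≤ {i = zero}  {j = suc j} anti _         = ≤-trans (anti j) (antitone-≤ anti z≤n)
antitone-≤ {i = suc i} {j = suc j} anti (s≤s i≤j) = antitone-≤ (anti ∘ suc) i≤j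

*-≤-sumBelow : Antitone f → ∀ n → n * f n ≤ sumBelow n f
*-≤-sumBelow anti zero    = z≤n
*-≤-sumBelow anti (suc n) = +-mono-≤ (antitone-≤ anti z≤n) (*-≤-sumBelow (anti ∘ suc) n)

*-<-sumBelow : Antitone f → ∀ n → f n < f 0 → n * f n < sumBelow n f
*-<-sumBelow anti zero    f0<f0 = contradiction refl (<⇒≢ f0<f0)
*-<-sumBelow anti (suc n) fn<f0 = +-mono-<-≤ fn<f0 (*-≤-sumBelow (anti ∘ suc) n)

sumBelow-<-flat : Antitone f → f i < f 0 → (∀ j → j ≤ i → g j ≡ g 0) →
  sumBelow (suc i) g ≤ sumBelow (suc i) f → sumBelow i g < sumBelow i f
sumBelow-<-flat {f} {i} {g} anti fi<f0 flat maj = ≰⇒> λ Σf≤Σg →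
  let Σf≤ig₀ : sumBelow i f ≤ i * g 0
      Σf≤ig₀ = ≤-trans Σf≤Σg (≤-reflexive (sumBelow-const i (λ j j<i → flat j (<⇒≤ j<i))))
      g₀≤fi : g 0 ≤ f i
      g₀≤fi = +-cancelˡ-≤ (i * g 0) _ _ (begin
        i * g 0 + g 0         ≡⟨ +-comm (i * g 0) (g 0) ⟩
        suc i * g 0           ≡⟨ sumBelow-const (suc i) (λ j j<1+i → flat j (≤-pred j<1+i)) ⟨
        sumBelow (suc i) g    ≤⟨ maj ⟩
        sumBelow (suc i) f    ≡⟨ sumBelow-snoc i f ⟩
        sumBelow i f + f i    ≤⟨ +-monoˡ-≤ (f i) Σf≤ig₀ ⟩
        i * g 0 + f i         ∎)
  in <-irrefl refl (begin-strict
       i * g 0      ≤⟨ *-monoʳ-≤ i g₀≤fi ⟩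
       i * f i      <⟨ *-<-sumBelow anti i fi<f0 ⟩
       sumBelow i f ≤⟨ Σf≤ig₀ ⟩
       i * g 0      ∎)
  where open ≤-Reasoning

decAt : ℕ → (ℕ → ℕ) → ℕ → ℕ
decAt zero    f zero    = pred (f 0)
decAt zero    f (suc j) = f (suc j)
decAt (suc k) f zero    = f 0
decAt (suc k) f (suc j) = decAt k (f ∘ suc) j

decAt-≤ : ∀ k f j → decAt k f j ≤ f j
decAt-≤ zero    f zero    = pred[n]≤n
decAt-≤ zero    f (suc j) = ≤-refl
decAt-≤ (suc k) f zero    = ≤-refl
decAt-≤ (suc k) f (suc j) = decAt-≤ k (f ∘ suc) j

decAt-self : ∀ k f → decAt k f k ≡ pred (f k)
decAt-self zero    f = refl
decAt-self (suc k) f = decAt-self k (f ∘ suc)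

decAt-other : ∀ k f j → j ≢ k → decAt k f j ≡ f j
decAt-other zero    f zero    j≢k = contradiction refl j≢k
decAt-other zero    f (suc j) _   = refl
decAt-other (suc k) f zero    _   = refl
decAt-other (suc k) f (suc j) j≢k = decAt-other k (f ∘ suc) j (j≢k ∘ cong suc)

decAt-antitone : Antitone f → f (suc k) < f k → Antitone (decAt k f)
decAt-antitone {k = zero}  anti f1<f0 zero    = <⇒≤pred f1<f0
decAt-antitone {k = zero}  anti _     (suc j) = anti (suc j)
decAt-antitone {f} {suc k} anti _     zero    = ≤-trans (decAt-≤ k (f ∘ suc) 0) (anti 0)
decAt-antitone {k = suc k} anti lt    (suc j) = decAt-antitone (anti ∘ suc) lt j

sumBelow-decAt-≤ : n ≤ k → sumBelow n (decAt k f) ≡ sumBelow n f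
sumBelow-decAt-≤ {zero}              _         = refl
sumBelow-decAt-≤ {suc n} {suc k} {f} (s≤s n≤k) = cong (f 0 +_) (sumBelow-decAt-≤ n≤k)

sumBelow-decAt-> : k < n → 0 < f k → suc (sumBelow n (decAt k f)) ≡ sumBelow n f
sumBelow-decAt-> {zero}  {suc n} {f} _         fk>0 =
  cong (_+ sumBelow n (f ∘ suc)) (suc-pred (f 0) {{>-nonZero fk>0}})
sumBelow-decAt-> {suc k} {suc n} {f} (s<s k<n) fk>0 =
  trans (sym (+-suc (f 0) _)) (cong (f 0 +_) (sumBelow-decAt-> k<n fk>0))

factorialProduct-decAt : k < n → 0 < f k → factorialProduct n f ≡ f k * factorialProduct n (decAt k f)
factorialProduct-decAt {zero}  {suc n} {f} _         fk>0 with f 0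
... | suc m = *-assoc (suc m) (m !) (factorialProduct n (f ∘ suc))
factorialProduct-decAt {suc k} {suc n} {f} (s<s k<n) fk>0 =
  trans (cong (f 0 ! *_) (factorialProduct-decAt k<n fk>0)) (x∙yz≈y∙xz (f 0 !) (f (suc k)) _)

-- An element of 𝒱_{v,c}, read as a function on ℕ that vanishes from index v on.
record IsPartition (v c : ℕ) (f : ℕ → ℕ) : Set where
  field
    antitone : Antitone f
    vanishes : ∀ j → v ≤ j → f j ≡ 0
    total    : sumBelow v f ≡ c

partition-zero : IsPartition v 0 f → ∀ j → f j ≡ 0
partition-zero {v} p j with j <? v
... | yes j<v = sumBelow≡0 v (IsPartition.total p) j j<v
... | no j≮v  = IsPartition.vanishes p j (≮⇒≥ j≮v)

partition-head-pos : IsPartition v (suc c) f → 0 < f 0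
partition-head-pos {v} {c} {f} p = n≢0⇒n>0 λ f0≡0 → 0≢1+n (begin
  0            ≡⟨ *-zeroʳ v ⟨
  v * 0        ≡⟨ sumBelow-const v (λ j _ → n≤0⇒n≡0 (subst (f j ≤_) f0≡0 (antitone-≤ antitone z≤n))) ⟨
  sumBelow v f ≡⟨ total ⟩
  suc c        ∎)
  where open IsPartition p
        open ≡-Reasoning

TopBlockEnd : (ℕ → ℕ) → ℕ → Set
TopBlockEnd f k = (∀ j → j ≤ k → f j ≡ f 0) × f (suc k) < f 0

topBlockEnd-pos : TopBlockEnd f k → 0 < f 0 → 0 < f k
topBlockEnd-pos {k = k} (flat , _) = subst (0 <_) (sym (flat k ≤-refl))

topBlockEnd : Antitone f → ∀ v → f v < f 0 → ∃[ k ] k < v × TopBlockEnd f k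
topBlockEnd anti zero    f0<f0 = contradiction refl (<⇒≢ f0<f0)
topBlockEnd {f} anti (suc v) f1+v<f0 with f v <? f 0
... | yes fv<f0 with topBlockEnd anti v fv<f0
...   | k , k<v , block = k , m<n⇒m<1+n k<v , block
topBlockEnd {f} anti (suc v) f1+v<f0 | no fv≮f0 = v , n<1+n v , flat , f1+v<f0
  where
  flat : ∀ j → j ≤ v → f j ≡ f 0
  flat j j≤v = ≤-antisym (antitone-≤ anti z≤n) (≤-trans (≮⇒≥ fv≮f0) (antitone-≤ anti j≤v))

partition-topBlockEnd : IsPartition v (suc c) f → ∃[ k ] k < v × TopBlockEnd f k
partition-topBlockEnd {v} {f = f} p = topBlockEnd antitone v (subst (_< f 0) (sym (vanishes v ≤-refl)) (partition-head-pos p))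
  where open IsPartition p

decAt-partition : IsPartition v (suc c) f → k < v → TopBlockEnd f k → IsPartition v c (decAt k f)
decAt-partition {v} {c} {f} {k} p k<v (flat , drop) = record
  { antitone = decAt-antitone antitone (subst (f (suc k) <_) (sym (flat k ≤-refl)) drop)
  ; vanishes = λ j v≤j → trans (decAt-other k f j (>⇒≢ (<-≤-trans k<v v≤j))) (vanishes j v≤j)
  ; total    = suc-injective (trans (sumBelow-decAt-> k<v (topBlockEnd-pos (flat , drop) (partition-head-pos p))) total)
  }
  where open IsPartition p

_≼ᶠ_ : (ℕ → ℕ) → (ℕ → ℕ) → Set
g ≼ᶠ f = ∀ i → sumBelow i g ≤ sumBelow i f

decAt-≼ᶠ : Antitone f → TopBlockEnd f k → TopBlockEnd g l → 0 < f 0 → 0 < g 0 →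
  g ≼ᶠ f → decAt l g ≼ᶠ decAt k f
decAt-≼ᶠ {f} {k} {g} {l} anti bf@(_ , dropf) bg@(flatg , _) f0>0 g0>0 maj i with i ≤? k | ≤-<-connex i l
... | yes i≤k | _ = begin
  sumBelow i (decAt l g) ≤⟨ sumBelow-mono i (decAt-≤ l g) ⟩
  sumBelow i g           ≤⟨ maj i ⟩
  sumBelow i f           ≡⟨ sumBelow-decAt-≤ i≤k ⟨
  sumBelow i (decAt k f) ∎
  where open ≤-Reasoning
... | no i≰k | inj₂ l<i = ≤-pred (subst₂ _≤_
  (sym (sumBelow-decAt-> l<i (topBlockEnd-pos bg g0>0)))
  (sym (sumBelow-decAt-> (≰⇒> i≰k) (topBlockEnd-pos bf f0>0)))
  (maj i))
... | no i≰k | inj₁ i≤l = ≤-pred (begin-strict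
  sumBelow i (decAt l g)       ≡⟨ sumBelow-decAt-≤ i≤l ⟩
  sumBelow i g                 <⟨ sumBelow-<-flat anti fi<f0 (λ j j≤i → flatg j (≤-trans j≤i i≤l)) (maj (suc i)) ⟩
  sumBelow i f                 ≡⟨ sumBelow-decAt-> (≰⇒> i≰k) (topBlockEnd-pos bf f0>0) ⟨
  suc (sumBelow i (decAt k f)) ∎)
  where
  open ≤-Reasoning
  fi<f0 : f i < f 0
  fi<f0 = ≤-<-trans (antitone-≤ anti (≰⇒> i≰k)) dropf

decAt-block-collision : ∀ {m} → (∀ j → j ≤ k → f j ≡ m) → (∀ j → j ≤ l → g j ≡ m) → 0 < m → k < l →
  decAt l g k ≢ decAt k f k
decAt-block-collision {k} {f} {l} {g} {suc m} flatf flatg _ k<l eq = <-irrefl m≡1+m (n<1+n m)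
  where
  m≡1+m : m ≡ suc m
  m≡1+m = begin
    m               ≡⟨ cong pred (flatf k ≤-refl) ⟨
    pred (f k)      ≡⟨ decAt-self k f ⟨
    decAt k f k     ≡⟨ eq ⟨
    decAt l g k     ≡⟨ decAt-other l g k (<⇒≢ k<l) ⟩
    g k             ≡⟨ flatg k (<⇒≤ k<l) ⟩
    suc m           ∎
    where open ≡-Reasoning

decAt-cancel : ∀ {m} → (∀ j → j ≤ k → f j ≡ m) → (∀ j → j ≤ l → g j ≡ m) → 0 < m →
  decAt l g ≗ decAt k f → g ≗ f
decAt-cancel {k} {f} {l} {g} flatf flatg m>0 eq j with <-cmp k l
... | tri< k<l _ _ = contradiction (eq k) (decAt-block-collision flatf flatg m>0 k<l)
... | tri> _ _ l<k = contradiction (sym (eq l)) (decAt-block-collision flatg flatf m>0 l<k)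
... | tri≈ _ refl _ with j ≟ k
...   | yes refl = trans (flatg k ≤-refl) (sym (flatf k ≤-refl))
...   | no j≢k   = trans (sym (decAt-other k g j j≢k)) (trans (eq j) (decAt-other k f j j≢k))

*-mono-<-either : ∀ {a b x y} → b ≤ a → y ≤ x → 0 < a → 0 < y → b < a ⊎ y < x → b * y < a * x
*-mono-<-either {a} {b} {x} {y} _   y≤x _   y>0 (inj₁ b<a) =
  <-≤-trans (*-monoˡ-< y {{>-nonZero y>0}} b<a) (*-monoʳ-≤ a y≤x)
*-mono-<-either {a} {b} {x} {y} b≤a _   a>0 _   (inj₂ y<x) =
  ≤-<-trans (*-monoˡ-≤ y b≤a) (*-monoʳ-< a {{>-nonZero a>0}} y<x)

factorialProduct-schur : ∀ c v → IsPartition v c f → IsPartition v c g → g ≼ᶠ f →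
  g ≗ f ⊎ factorialProduct v g < factorialProduct v f
factorialProduct-schur zero v pf pg _ = inj₁ λ j → trans (partition-zero pg j) (sym (partition-zero pf j))
factorialProduct-schur {f} {g} (suc c) v pf pg maj
  with partition-topBlockEnd pf | partition-topBlockEnd pg
... | k , k<v , bf@(flatf , _) | l , l<v , bg@(flatg , _) =
  step (factorialProduct-schur c v (decAt-partition pf k<v bf) (decAt-partition pg l<v bg)
                               (decAt-≼ᶠ (IsPartition.antitone pf) bf bg f0>0 g0>0 maj))
  where
  f0>0 : 0 < f 0
  f0>0 = partition-head-pos pf
  g0>0 : 0 < g 0
  g0>0 = partition-head-pos pg
  g0≤f0 : g 0 ≤ f 0
  g0≤f0 = subst₂ _≤_ (+-identityʳ (g 0)) (+-identityʳ (f 0)) (maj 1)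
  F′ G′ : ℕ
  F′ = factorialProduct v (decAt k f)
  G′ = factorialProduct v (decAt l g)
  F≡ : factorialProduct v f ≡ f 0 * F′
  F≡ = trans (factorialProduct-decAt k<v (topBlockEnd-pos bf f0>0)) (cong (_* F′) (flatf k ≤-refl))
  G≡ : factorialProduct v g ≡ g 0 * G′
  G≡ = trans (factorialProduct-decAt l<v (topBlockEnd-pos bg g0>0)) (cong (_* G′) (flatg l ≤-refl))
  strict : G′ ≤ F′ → g 0 < f 0 ⊎ G′ < F′ → factorialProduct v g < factorialProduct v f
  strict G′≤F′ g0<f0⊎G′<F′ = subst₂ _<_ (sym G≡) (sym F≡)
    (*-mono-<-either g0≤f0 G′≤F′ f0>0 (factorialProduct-pos v (decAt l g)) g0<f0⊎G′<F′)
  step : decAt l g ≗ decAt k f ⊎ G′ < F′ → g ≗ f ⊎ factorialProduct v g < factorialProduct v f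
  step (inj₂ G′<F′) = inj₂ (strict (<⇒≤ G′<F′) (inj₂ G′<F′))
  step (inj₁ g′≗f′) with m≤n⇒m<n∨m≡n g0≤f0
  ... | inj₁ g0<f0 = inj₂ (strict (≤-reflexive (factorialProduct-cong v g′≗f′)) (inj₁ g0<f0))
  ... | inj₂ g0≡f0 = inj₁ (decAt-cancel flatf (λ j j≤l → trans (flatg j j≤l) g0≡f0) f0>0 g′≗f′)

entry : Vec ℕ v → ℕ → ℕ
entry []       _       = 0
entry (x ∷ xs) zero    = x
entry (x ∷ xs) (suc j) = entry xs j

lookup-fromℕ< : ∀ (s : Vec ℕ v) i (i<v : i < v) → lookup s (fromℕ< i<v) ≡ entry s i
lookup-fromℕ< (x ∷ xs) zero    _         = refl
lookup-fromℕ< (x ∷ xs) (suc i) (s<s i<v) = lookup-fromℕ< xs i i<v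

entry-vanishes : ∀ (s : Vec ℕ v) j → v ≤ j → entry s j ≡ 0
entry-vanishes []       j       _         = refl
entry-vanishes (x ∷ xs) (suc j) (s≤s v≤j) = entry-vanishes xs j v≤j

entry-antitone : (s : Vec ℕ v) → NonIncreasing s → Antitone (entry s)
entry-antitone {v} s ni j with suc j <? v
... | yes 1+j<v = subst₂ _≤_ (lookup-fromℕ< s (suc j) 1+j<v) (lookup-fromℕ< s j (<-trans (n<1+n j) 1+j<v)) (ni j 1+j<v)
... | no 1+j≮v  = subst (_≤ entry s j) (sym (entry-vanishes s (suc j) (≮⇒≥ 1+j≮v))) z≤n

entry-injective : (q s : Vec ℕ v) → entry q ≗ entry s → q ≡ s
entry-injective []       []       _   = refl
entry-injective (x ∷ xs) (y ∷ ys) q≗s = cong₂ _∷_ (q≗s 0) (entry-injective xs ys (q≗s ∘ suc))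

psum-entry : ∀ i (s : Vec ℕ v) → psum i s ≡ sumBelow i (entry s)
psum-entry zero    s        = refl
psum-entry (suc i) []       = sym (trans (sumBelow-const i (λ _ _ → refl)) (*-zeroʳ i))
psum-entry (suc i) (x ∷ xs) = cong (x +_) (psum-entry i xs)

vsum-entry : (s : Vec ℕ v) → vsum s ≡ sumBelow v (entry s)
vsum-entry []       = refl
vsum-entry (x ∷ xs) = cong (x +_) (vsum-entry xs)

psum-beyond : ∀ i (s : Vec ℕ v) → v ≤ i → psum i s ≡ vsum s
psum-beyond zero    []       _         = refl
psum-beyond (suc i) []       _         = refl
psum-beyond (suc i) (x ∷ xs) (s≤s v≤i) = cong (x +_) (psum-beyond i xs v≤i)

entry-partition : (s : Vec ℕ v) → InV v c s → IsPartition v c (entry s)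
entry-partition s (ni , Σs≡c) = record
  { antitone = entry-antitone s ni
  ; vanishes = entry-vanishes s
  ; total    = trans (sym (vsum-entry s)) Σs≡c
  }

entry-≼ᶠ : (q s : Vec ℕ v) → InV v c q → InV v c s → q ≼ s → entry q ≼ᶠ entry s
entry-≼ᶠ q s _ _ q≼s zero = z≤n
entry-≼ᶠ {v} q s (_ , Σq≡c) (_ , Σs≡c) q≼s (suc i) with suc i <? v
... | yes 1+i<v = subst₂ _≤_ (psum-entry (suc i) q) (psum-entry (suc i) s) (q≼s (suc i) (s≤s z≤n) 1+i<v)
... | no 1+i≮v  = ≤-reflexive (begin
  sumBelow (suc i) (entry q) ≡⟨ psum-entry (suc i) q ⟨
  psum (suc i) q             ≡⟨ psum-beyond (suc i) q (≮⇒≥ 1+i≮v) ⟩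
  vsum q                     ≡⟨ trans Σq≡c (sym Σs≡c) ⟩
  vsum s                     ≡⟨ psum-beyond (suc i) s (≮⇒≥ 1+i≮v) ⟨
  psum (suc i) s             ≡⟨ psum-entry (suc i) s ⟩
  sumBelow (suc i) (entry s) ∎)
  where open ≡-Reasoning

ff-≤ : ∀ a b → a ≤ b → ff a b ≡ 1
ff-≤ zero    b _   = refl
ff-≤ (suc a) b a<b with b ≤? a
... | yes b≤a = contradiction (<-≤-trans a<b b≤a) (<-irrefl refl)
... | no _    = refl

ff-≥ : ∀ a b → b ≤ a → ff a b * b ! ≡ a !
ff-≥ zero    zero z≤n = refl
ff-≥ (suc a) b    b≤1+a with b ≤? a
... | yes b≤a = trans (*-assoc (suc a) (ff a b) (b !)) (cong (suc a *_) (ff-≥ a b b≤a))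
... | no b≰a  rewrite ≤-antisym b≤1+a (≰⇒> b≰a) = +-identityʳ (suc a !)

ff-*-! : ∀ a b → ff a b * b ! ≡ ff b a * a !
ff-*-! a b with ≤-total a b
... | inj₁ a≤b = trans (cong (_* b !) (ff-≤ a b a≤b)) (trans (+-identityʳ (b !)) (sym (ff-≥ b a a≤b)))
... | inj₂ b≤a = trans (ff-≥ a b b≤a) (sym (trans (cong (_* a !) (ff-≤ b a b≤a)) (+-identityʳ (a !))))

ff-pos : ∀ a b → 0 < ff a b
ff-pos zero    b = z<s
ff-pos (suc a) b with b ≤? a
... | yes _ = *-mono-≤ (s≤s (z≤n {a})) (ff-pos a b)
... | no _  = z<s

P-pos : (s q : Vec ℕ v) → 0 < P s q
P-pos []       []       = z<s
P-pos (x ∷ xs) (y ∷ ys) = *-mono-≤ (ff-pos x y) (P-pos xs ys)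

P-*-factorialProduct : (q s : Vec ℕ v) →
  P q s * factorialProduct v (entry s) ≡ P s q * factorialProduct v (entry q)
P-*-factorialProduct []       []       = refl
P-*-factorialProduct {suc v} (x ∷ xs) (y ∷ ys) = begin
  (ff x y * P xs ys) * (y ! * F ys) ≡⟨ interchange (ff x y) (P xs ys) (y !) (F ys) ⟩
  (ff x y * y !) * (P xs ys * F ys) ≡⟨ cong₂ _*_ (ff-*-! x y) (P-*-factorialProduct xs ys) ⟩
  (ff y x * x !) * (P ys xs * F xs) ≡⟨ interchange (ff y x) (x !) (P ys xs) (F xs) ⟩
  (ff y x * P ys xs) * (x ! * F xs) ∎
  where
  open ≡-Reasoning
  F : Vec ℕ v → ℕ
  F = factorialProduct v ∘ entry

cross-< : ∀ {a b x y} → a * x ≡ b * y → y < x → 0 < b → a < b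
cross-< {a} {b} {x} {y} ax≡by y<x b>0 =
  *-cancelʳ-< x a b (≤-<-trans (≤-reflexive ax≡by) (*-monoʳ-< b {{>-nonZero b>0}} y<x))

lemma2p1 : (v c : ℕ) (q s : Vec ℕ v) → InV v c q → InV v c s → q ≼ s →
    (P q s ≤ P s q) × (¬ (q ≡ s) → P q s < P s q)
lemma2p1 v c q s q∈V s∈V q≼s
  with factorialProduct-schur c v (entry-partition s s∈V) (entry-partition q q∈V) (entry-≼ᶠ q s q∈V s∈V q≼s)
... | inj₁ q≗s = ≤-reflexive (cong₂ P q≡s (sym q≡s)) , contradiction q≡s
  where q≡s = entry-injective q s q≗s
... | inj₂ Fq<Fs = <⇒≤ P<P , λ _ → P<P
  where P<P = cross-< (P-*-factorialProduct q s) Fq<Fs (P-pos s q)
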